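{- Let $(D,\sqsubseteq)$ be a finite partial ordering with least element $\bot$ and greatest element $\top$, and let $F$ be a finite set of functions $D\to D$, each of which is inflationary and monotonic. Consider the Generic Iteration Algorithm (GI) described in the context, where for all $G,g,d$ the set $\mathit{update}(G,g,d)\subseteq F$ satisfies conditions A, B and C. Then every execution of GI terminates, and upon termination the variable $d$ equals the least common fixpoint of the functions in $F$.
   Context: A function $f:D\to D$ is inflationary if $x\sqsubseteq f(x)$ for all $x$, and monotonic if $x\sqsubseteq y$ implies $f(x)\sqsubseteq f(y)$. Generic Iteration Algorithm (GI): $d:=\bot$; $G:=F$; while $G\neq\emptyset$ and $d\neq\top$ do: choose $g\in G$; $G:=G-\{g\}$; $G:=G\cup \mathit{update}(G,g,d)$; $d:=g(d)$; end. Here, for all $G\subseteq F$, $g\in F$ and $d\in D$, $\mathit{update}(G,g,d)$ is a subset of $F$ such that: (A) $\{f\in F-G \mid f(d)=d \wedge f(g(d))\neq g(d)\}\subseteq \mathit{update}(G,g,d)$; (B) $g(d)=d$ implies $\mathit{update}(G,g,d)=\emptyset$; (C) $g(g(d))\neq g(d)$ implies $g\in\mathit{update}(G,g,d)$. -}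

module Defs where

open import Data.Nat using (ℕ)
open import Data.Fin using (Fin)
open import Data.Fin.Subset using (Subset; _∈_; _∪_; _-_) renaming (⊥ to ∅)
open import Data.Product using (_×_; _,_)
open import Data.Sum using (_⊎_)
open import Relation.Binary.PropositionalEquality using (_≡_; _≢_)
open import Relation.Binary.Construct.Closure.ReflexiveTransitive using (Star)

-- The domain D is Fin n (any finite poset is isomorphic to one with carrier Fin n);
-- the finite set of functions F is given as a family  F : Fin m → D → D  indexed
-- by Fin m, and subsets G ⊆ F are subsets (Subset m) of the index set Fin m.

State : ℕ → ℕ → Set
State n m = Subset m × Fin n

-- One iteration of the while loop (guard: G ≠ ∅ and d ≠ ⊤), with the
-- nondeterministic choice of g ∈ G:
--   G := G - {g};  G := G ∪ update(G,g,d);  d := g(d)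
data Step {n m : ℕ} (F : Fin m → Fin n → Fin n) (top : Fin n)
          (update : Subset m → Fin m → Fin n → Subset m)
          : State n m → State n m → Set where
  step : ∀ {G d} (g : Fin m) → G ≢ ∅ → d ≢ top → g ∈ G →
         Step F top update (G , d) ((G - g) ∪ update (G - g) g d , F g d)

Reach : {n m : ℕ} (F : Fin m → Fin n → Fin n) (top : Fin n)
        (update : Subset m → Fin m → Fin n → Subset m) →
        State n m → State n m → Set
Reach F top update = Star (Step F top update)

Terminated : {n m : ℕ} (top : Fin n) → State n m → Set
Terminated top (G , d) = G ≡ ∅ ⊎ d ≡ top

-- Termination: every loop iteration either strictly increases d (when g moves it)
-- or leaves d fixed and, by condition B, strictly shrinks G; the lexicographic
-- order on (d, |G|) is well founded because D is finite.
-- Correctness: the loop maintains the invariant that every function outside G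
-- fixes d (conditions A and C put back exactly the functions that g's move may
-- have disturbed) and that d lies below every common fixpoint (by monotonicity,
-- starting from ⊥). On exit either G = ∅, or d = ⊤, which every inflationary
-- function fixes; in both cases d is a common fixpoint, hence the least one.
module Submission where

open import Defs
open import Data.Nat using (ℕ; _<_)
open import Data.Nat.Induction using (<-wellFounded)
open import Data.Nat.Properties using (module ≤-Reasoning)
open import Level using (Level)
open import Data.Fin using (Fin; _≟_)
open import Data.Fin.Induction using (po-noetherian)
open import Data.Fin.Subset using (Subset; _∈_; _∉_; _∪_; _-_; ∣_∣) renaming (⊥ to ∅; ⊤ to full)
open import Data.Fin.Subset.Properties using (∉⊥; ∈⊤; p⊆p∪q; q⊆p∪q; ∪-identityʳ; x∈p∧x≢y⇒x∈p-y; x∈p⇒∣p-x∣<∣p∣)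
open import Data.Product using (_×_; _,_)
open import Data.Product.Relation.Binary.Lex.Strict using (×-Lex; ×-wellFounded)
open import Data.Sum using (inj₁; inj₂)
open import Function using (_∘_; flip)
open import Relation.Nullary.Decidable using (yes; no; decidable-stable)
open import Relation.Nullary.Negation using (contradiction)
open import Relation.Binary using (Rel; IsPartialOrder)
open import Relation.Binary.PropositionalEquality using (_≡_; _≢_; refl; sym; cong)
open import Relation.Binary.Construct.Closure.ReflexiveTransitive using (ε; _◅_)
import Relation.Binary.Construct.NonStrictToStrict as ToStrict
import Relation.Binary.Construct.On as On
open import Induction.WellFounded using (WellFounded; Acc; module Subrelation)

module Termination
    {n m : ℕ} {ℓ : Level} {_⊑_ : Rel (Fin n) ℓ} (isPO : IsPartialOrder _≡_ _⊑_)
    (top : Fin n) (F : Fin m → Fin n → Fin n)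
    (inflationary : ∀ f x → x ⊑ F f x)
    (update : Subset m → Fin m → Fin n → Subset m)
    (condB : ∀ G g d → F g d ≡ d → update G g d ≡ ∅) where

  _⊏_ : Rel (Fin n) ℓ
  _⊏_ = ToStrict._<_ _≡_ _⊑_

  _≺_ : Rel (Fin n × ℕ) ℓ
  _≺_ = ×-Lex _≡_ (flip _⊏_) _<_

  measure : State n m → Fin n × ℕ
  measure (G , d) = d , ∣ G ∣

  step-decreases : ∀ {s s′} → Step F top update s s′ → measure s′ ≺ measure s
  step-decreases {G , d} (step g _ _ g∈G) with F g d ≟ d
  ... | no  moved = inj₁ (inflationary g d , moved ∘ sym)
  ... | yes fixed = inj₂ (fixed , shrinks)
    where
    open ≤-Reasoning
    shrinks : ∣ (G - g) ∪ update (G - g) g d ∣ < ∣ G ∣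
    shrinks = begin-strict
      ∣ (G - g) ∪ update (G - g) g d ∣  ≡⟨ cong (∣_∣ ∘ ((G - g) ∪_)) (condB (G - g) g d fixed) ⟩
      ∣ (G - g) ∪ ∅ ∣                   ≡⟨ cong ∣_∣ (∪-identityʳ (G - g)) ⟩
      ∣ G - g ∣                         <⟨ x∈p⇒∣p-x∣<∣p∣ g∈G ⟩
      ∣ G ∣                             ∎

  Step-noetherian : WellFounded (flip (Step F top update))
  Step-noetherian = Subrelation.wellFounded step-decreases
    (On.wellFounded measure (×-wellFounded (po-noetherian isPO) <-wellFounded))

module Correctness
    {n m : ℕ} {ℓ : Level} {_⊑_ : Rel (Fin n) ℓ} (isPO : IsPartialOrder _≡_ _⊑_)
    (bot top : Fin n) (bot-least : ∀ x → bot ⊑ x) (top-greatest : ∀ x → x ⊑ top)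
    (F : Fin m → Fin n → Fin n)
    (inflationary : ∀ f x → x ⊑ F f x)
    (monotonic : ∀ f x y → x ⊑ y → F f x ⊑ F f y)
    (update : Subset m → Fin m → Fin n → Subset m)
    (condA : ∀ G g d f → f ∉ G → F f d ≡ d → F f (F g d) ≢ F g d → f ∈ update G g d)
    (condC : ∀ G g d → F g (F g d) ≢ F g d → g ∈ update G g d) where

  open IsPartialOrder isPO using (antisym; ≤-respʳ-≈)

  CommonFixpoint : Fin n → Set
  CommonFixpoint e = ∀ f → F f e ≡ e

  Invariant : State n m → Set ℓ
  Invariant (G , d) = (∀ f → f ∉ G → F f d ≡ d) × (∀ e → CommonFixpoint e → d ⊑ e)

  Invariant-initial : Invariant (full , bot)
  Invariant-initial = (λ f f∉full → contradiction ∈⊤ f∉full) , (λ e _ → bot-least e)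

  Invariant-step : ∀ {s s′} → Step F top update s s′ → Invariant s → Invariant s′
  Invariant-step {G , d} (step g _ _ g∈G) (outside-fixed , below-fixpoints) =
    outside-fixed′ , below-fixpoints′
    where
    moved⇒∈update : ∀ f → f ∉ G - g → F f (F g d) ≢ F g d → f ∈ update (G - g) g d
    moved⇒∈update f f∉G-g moved with f ≟ g
    ... | yes refl = condC (G - g) g d moved
    ... | no  f≢g  = condA (G - g) g d f f∉G-g
                       (outside-fixed f (f∉G-g ∘ flip x∈p∧x≢y⇒x∈p-y f≢g)) moved

    outside-fixed′ : ∀ f → f ∉ (G - g) ∪ update (G - g) g d → F f (F g d) ≡ F g d
    outside-fixed′ f f∉G′ = decidable-stable (F f (F g d) ≟ F g d) λ moved →
      f∉G′ (q⊆p∪q (G - g) _ (moved⇒∈update f (f∉G′ ∘ p⊆p∪q _) moved))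

    below-fixpoints′ : ∀ e → CommonFixpoint e → F g d ⊑ e
    below-fixpoints′ e fixed = ≤-respʳ-≈ (fixed g) (monotonic g d e (below-fixpoints e fixed))

  Invariant-reach : ∀ {s s′} → Reach F top update s s′ → Invariant s → Invariant s′
  Invariant-reach ε           inv = inv
  Invariant-reach (st ◅ sts) inv = Invariant-reach sts (Invariant-step st inv)

  terminated⇒common-fixpoint : ∀ {G d} → Terminated top (G , d) →
                                (∀ f → f ∉ G → F f d ≡ d) → CommonFixpoint d
  terminated⇒common-fixpoint (inj₁ refl) outside-fixed f = outside-fixed f ∉⊥
  terminated⇒common-fixpoint (inj₂ refl) _             f = antisym (top-greatest _) (inflationary f top)

theorem1 : (n m : ℕ) (_⊑_ : Rel (Fin n) Level.zero) → IsPartialOrder _≡_ _⊑_ →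
    (bot top : Fin n) → (∀ x → bot ⊑ x) → (∀ x → x ⊑ top) →
    (F : Fin m → Fin n → Fin n) →
    (∀ f x → x ⊑ F f x) →
    (∀ f x y → x ⊑ y → F f x ⊑ F f y) →
    (update : Subset m → Fin m → Fin n → Subset m) →
    (∀ G g d f → f ∉ G → F f d ≡ d → F f (F g d) ≢ F g d → f ∈ update G g d) →
    (∀ G g d → F g d ≡ d → update G g d ≡ ∅) →
    (∀ G g d → F g (F g d) ≢ F g d → g ∈ update G g d) →
    Acc (λ s' s → Step F top update s s') (full , bot)
    × (∀ G d → Reach F top update (full , bot) (G , d) → Terminated top (G , d) →
         (∀ f → F f d ≡ d) × (∀ e → (∀ f → F f e ≡ e) → d ⊑ e))
theorem1 n m _⊑_ isPO bot top bot-least top-greatest F inflationary monotonic update condA condB condC =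
  Step-noetherian (full , bot) , least-common-fixpoint
  where
  open Termination isPO top F inflationary update condB
  open Correctness isPO bot top bot-least top-greatest F inflationary monotonic update condA condC

  least-common-fixpoint : ∀ G d → Reach F top update (full , bot) (G , d) → Terminated top (G , d) →
                          CommonFixpoint d × (∀ e → CommonFixpoint e → d ⊑ e)
  least-common-fixpoint G d reach done =
    let (outside-fixed , below-fixpoints) = Invariant-reach reach Invariant-initial
    in terminated⇒common-fixpoint done outside-fixed , below-fixpoints
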